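{- There is a constant $c>0$ such that for every $n$ there exists a circular-arc graph $G$ on $n$ vertices with $\mathrm{sd}(G)\ge c\sqrt{n}$.
   Context: A circular-arc graph is the intersection graph of a finite family of arcs of a circle (vertices are the arcs, two adjacent iff the arcs intersect). For a graph $G$ and distinct vertices $u,v$, $\mathrm{sd}_G(u,v)$ is the number of vertices other than $u,v$ that are adjacent to exactly one of $u$ and $v$. The symmetric difference of $G$ is $\mathrm{sd}(G)=\max_H \min_{u\ne v\in V(H)} \mathrm{sd}_H(u,v)$, the maximum taken over all induced subgraphs $H$ of $G$ with at least two vertices. -}

module Defs where

open import Data.Nat using (ℕ; zero; suc; _+_; _*_; _≤ᵇ_; _⊓_; _⊔_)
open import Data.Bool using (Bool; true; false; _∧_; _∨_; not; _xor_; if_then_else_)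
open import Data.Fin using (Fin; toℕ; _≟_)
open import Data.Vec using (Vec; []; _∷_; lookup; toList)
open import Data.List using (List; []; _∷_; map; concatMap; foldr; allFin; _++_)
open import Data.Nat.ListAction using (sum)
open import Data.Bool.ListAction using (any)
open import Data.Product using (_×_; _,_; Σ; ∃-syntax)
open import Relation.Nullary.Decidable using (⌊_⌋)
open import Relation.Nullary using (¬_)
open import Relation.Binary.PropositionalEquality using (_≡_)

-- Graphs on the vertex set Fin n, given by a Boolean adjacency function.
-- Only off-diagonal entries are ever used.

Graph : ℕ → Set
Graph n = Fin n → Fin n → Bool

_≡ᶠ_ : ∀ {n} → Fin n → Fin n → Bool
u ≡ᶠ v = ⌊ u ≟ v ⌋

-- An arc starts at 'start' and covers start, start+1, …, start+len (mod m);
-- len ranges over 0 … m-1 (len = m-1 is the whole circle).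

record Arc (m : ℕ) : Set where
  constructor arc
  field
    start : Fin m
    len   : Fin m

open Arc public

inInterval : ℕ → ℕ → ℕ → Bool
inInterval lo hi x = (lo ≤ᵇ x) ∧ (x ≤ᵇ hi)

onArc : ∀ {m} → Arc m → Fin m → Bool
onArc {m} a p =
  inInterval (toℕ (start a)) (toℕ (start a) + toℕ (len a)) (toℕ p) ∨
  inInterval (toℕ (start a)) (toℕ (start a) + toℕ (len a)) (toℕ p + m)

intersects : ∀ {m} → Arc m → Arc m → Bool
intersects {m} a b = any (λ p → onArc a p ∧ onArc b p) (allFin m)

IsCircularArcGraph : ∀ {n} → Graph n → Set
IsCircularArcGraph {n} G =
  ∃[ m ] Σ (Fin n → Arc m) λ arcs →
    ∀ (u v : Fin n) → ¬ (u ≡ v) → G u v ≡ intersects (arcs u) (arcs v)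

-- Symmetric difference.
-- An induced subgraph H is given by its vertex set S (a Boolean vector).

inS : ∀ {n} → Vec Bool n → Fin n → Bool
inS S w = lookup S w

size : ∀ {n} → Vec Bool n → ℕ
size S = sum (map (λ b → if b then 1 else 0) (toList S))

sdIn : ∀ {n} → Graph n → Vec Bool n → Fin n → Fin n → ℕ
sdIn {n} G S u v = sum (map count (allFin n))
  where
  count : Fin n → ℕ
  count w = if inS S w ∧ not (w ≡ᶠ u) ∧ not (w ≡ᶠ v) ∧ (G u w xor G v w)
            then 1 else 0

pairsIn : ∀ {n} → Vec Bool n → List (Fin n × Fin n)
pairsIn {n} S = concatMap (λ u → concatMap (λ v →
    if inS S u ∧ inS S v ∧ not (u ≡ᶠ v) then (u , v) ∷ [] else [])
    (allFin n)) (allFin n)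

-- min over distinct pairs u,v of H of sd_H(u,v).  (The fold starts at n,
-- which is ≥ every sd_H(u,v); so for |S| ≥ 2 this is the true minimum.)
minSd : ∀ {n} → Graph n → Vec Bool n → ℕ
minSd {n} G S = foldr _⊓_ n (map (λ p → sdIn G S (Data.Product.proj₁ p) (Data.Product.proj₂ p)) (pairsIn S))

allSubsets : ∀ n → List (Vec Bool n)
allSubsets zero = [] ∷ []
allSubsets (suc n) = map (true ∷_) (allSubsets n) ++ map (false ∷_) (allSubsets n)

-- sd(G) = max over induced subgraphs H with ≥ 2 vertices of minSd
-- (convention: 0 if G has fewer than 2 vertices)
sd : ∀ {n} → Graph n → ℕ
sd {n} G = foldr _⊔_ 0
  (map (λ S → if 2 ≤ᵇ size S then minSd G S else 0) (allSubsets n))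

-- On a circle with M = 2h points take the 2h² arcs of length < h. For two distinct such arcs A, B
-- and a length j < h, an arc of length j starting at z meets A iff z lies on A extended backwards
-- by j. The two extended arcs are distinct and miss a point of the circle, so they differ at some z,
-- giving a distinguishing arc of every length j < h. Hence any two of the 2h² arcs have symmetric
-- difference at least h − 2, and taking h maximal with 2h² ≤ n gives n ≤ 32 sd(G)² once n ≥ 18.

module Submission where

open import Defs
open import Data.Bool using (Bool; true; false; T; _∧_; not; _xor_; if_then_else_)
open import Data.Bool.Properties using (T-∧; T-∨; T-≡)
open import Data.Bool.ListAction using (any)
open import Data.Fin using (Fin; zero; suc; toℕ; fromℕ<; _≟_; punchIn; punchOut; _↑ˡ_; inject≤)
open import Data.Fin.Properties
  using (toℕ<n; toℕ-fromℕ<; toℕ-injective; toℕ-↑ˡ; ↑ˡ-injective; toℕ-inject≤; inject≤-injective; punchInᵢ≢i; punchIn-punchOut; punchOut-injective; 0≢1+n; suc-injective)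
open import Data.List using ([]; _∷_; map; allFin)
import Data.List as List
open import Data.List.Membership.Propositional using (_∈_)
open import Data.List.Membership.Propositional.Properties using (∈-++⁺ˡ; ∈-++⁺ʳ; ∈-map⁺)
open import Data.List.Properties using (foldr-preservesᵇ; foldr-preservesᵒ)
open import Data.List.Relation.Unary.All using (All)
import Data.List.Relation.Unary.All as All
import Data.List.Relation.Unary.All.Properties as All
open import Data.List.Relation.Unary.Any using (here)
import Data.List.Relation.Unary.Any as Any
open import Data.List.Relation.Unary.Any.Properties using (any⁺; any⁻; tabulate⁺; tabulate⁻)
import Data.List.Relation.Unary.Any.Properties as Any
open import Data.Nat using (ℕ; zero; suc; _+_; _*_; _∸_; _≤_; _<_; _≤ᵇ_; _<ᵇ_; _⊔_; z≤n; s≤s; s≤s⁻¹; NonZero; >-nonZero; >-nonZero⁻¹)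
open import Data.Nat.Divisibility using (n∣m*n)
open import Data.Nat.ListAction using (sum)
open import Data.Nat.Properties hiding (_≟_; 0≢1+n; suc-injective)
open import Data.Nat.DivMod
open import Data.Nat.Tactic.RingSolver using (solve-∀)
open import Algebra.Properties.CommutativeMonoid.Sum +-0-commutativeMonoid
  using (sum-remove; ∑-distrib-+; sum-cong-≗; sum-replicate-zero; sum-syntax)
  renaming (sum to ∑)
open import Data.Product using (Σ; _×_; _,_; proj₁; proj₂; ∃-syntax; map₂)
open import Data.Sum using (_⊎_; inj₁; inj₂; [_,_])
open import Data.Vec using (Vec; tabulate)
open import Data.Vec.Properties using (lookup∘tabulate)
import Data.Vec as Vec
open import Data.Vec.Functional using (Vector; removeAt)
open import Function using (_∘_)
open import Function.Bundles using (_⇔_; mk⇔; Equivalence)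
open import Function.Definitions using (Injective)
open import Relation.Binary.Definitions using (tri<; tri≈; tri>)
open import Relation.Binary.PropositionalEquality
  using (_≡_; _≢_; refl; sym; trans; cong; cong₂; subst; module ≡-Reasoning)
open import Relation.Nullary using (yes; no; ¬_; contradiction)
open import Relation.Nullary.Decidable using (dec-true; dec-false; isYes≗does)
open ≡-Reasoning

%-absorbʳ : ∀ m n d .{{_ : NonZero d}} → (m + n % d) % d ≡ (m + n) % d
%-absorbʳ m n d = begin
  (m + n % d) % d          ≡⟨ %-distribˡ-+ m (n % d) d ⟩
  (m % d + n % d % d) % d  ≡⟨ cong (λ k → (m % d + k) % d) (m%n%n≡m%n n d) ⟩
  (m % d + n % d) % d      ≡⟨ %-distribˡ-+ m n d ⟨
  (m + n) % d              ∎

%-absorbˡ : ∀ m n d .{{_ : NonZero d}} → (m % d + n) % d ≡ (m + n) % d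
%-absorbˡ m n d = begin
  (m % d + n) % d  ≡⟨ cong (_% d) (+-comm (m % d) n) ⟩
  (n + m % d) % d  ≡⟨ %-absorbʳ n m d ⟩
  (n + m) % d      ≡⟨ cong (_% d) (+-comm n m) ⟩
  (m + n) % d      ∎

%-split : ∀ {a d} .{{_ : NonZero d}} → a < d + d → a % d ≡ a ⊎ a % d + d ≡ a
%-split {a} {d} a<2d with a <? d
... | yes a<d = inj₁ (m<n⇒m%n≡m a<d)
... | no a≮d = inj₂ (begin
  a % d + d        ≡⟨ cong (_+ d) (m≤n⇒[n∸m]%m≡n%m d≤a) ⟨
  (a ∸ d) % d + d  ≡⟨ cong (_+ d) (m<n⇒m%n≡m (m<n+o⇒m∸n<o a d a<2d)) ⟩
  a ∸ d + d        ≡⟨ m∸n+n≡m d≤a ⟩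
  a                ∎)
  where d≤a = ≮⇒≥ a≮d

inInterval⇔ : ∀ lo hi x → T (inInterval lo hi x) ⇔ (lo ≤ x × x ≤ hi)
inInterval⇔ lo hi x = mk⇔
  (λ t → let (lo≤x , x≤hi) = Equivalence.to T-∧ t in ≤ᵇ⇒≤ lo x lo≤x , ≤ᵇ⇒≤ x hi x≤hi)
  (λ (lo≤x , x≤hi) → Equivalence.from T-∧ (≤⇒≤ᵇ lo≤x , ≤⇒≤ᵇ x≤hi))

T-any-allFin : ∀ {n} (f : Fin n → Bool) → T (any f (allFin n)) ⇔ (∃[ i ] T (f i))
T-any-allFin f = mk⇔ (λ t → tabulate⁻ (any⁻ f _ t)) (λ (i , fi) → any⁺ f (tabulate⁺ i fi))

T-xor : ∀ {a b} → (T a × ¬ T b) ⊎ (¬ T a × T b) → T (a xor b)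
T-xor {true}  {true}  (inj₁ (_ , ¬b)) = ¬b _
T-xor {true}  {true}  (inj₂ (¬a , _)) = ¬a _
T-xor {true}  {false} _              = _
T-xor {false} {true}  _              = _
T-xor {false} {false} (inj₁ (a , _)) = a
T-xor {false} {false} (inj₂ (_ , b)) = b

indicator : Bool → ℕ
indicator b = if b then 1 else 0

sum-map-tabulate : ∀ {A : Set} {n} (g : Fin n → A) (c : A → ℕ) →
  sum (map c (List.tabulate g)) ≡ ∑[ i < n ] c (g i)
sum-map-tabulate {n = zero}  g c = refl
sum-map-tabulate {n = suc n} g c = cong (c (g zero) +_) (sum-map-tabulate (g ∘ suc) c)

size-tabulate : ∀ {n} (p : Fin n → Bool) → size (tabulate p) ≡ ∑[ i < n ] indicator (p i)
size-tabulate {zero}  p = refl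
size-tabulate {suc n} p = cong (indicator (p zero) +_) (size-tabulate (p ∘ suc))

injective⇒≤∑ : ∀ {g n} (c : Vector ℕ n) {f : Fin g → Fin n} →
  Injective _≡_ _≡_ f → (∀ i → 1 ≤ c (f i)) → g ≤ ∑[ w < n ] c w
injective⇒≤∑ {zero}          c f-inj pos = z≤n
injective⇒≤∑ {suc g} {zero}  c {f} f-inj pos with () ← f zero
injective⇒≤∑ {suc g} {suc n} c {f} f-inj pos =
  subst (suc g ≤_) (sym (sum-remove {i = f zero} c))
    (+-mono-≤ (pos zero) (injective⇒≤∑ (removeAt c (f zero)) f′-inj pos′))
  where
  f₀≢ : ∀ i → f zero ≢ f (suc i)
  f₀≢ i = 0≢1+n ∘ f-inj
  f′ : Fin g → Fin n
  f′ i = punchOut (f₀≢ i)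
  f′-inj : Injective _≡_ _≡_ f′
  f′-inj eq = suc-injective (f-inj (punchOut-injective (f₀≢ _) (f₀≢ _) eq))
  pos′ : ∀ i → 1 ≤ removeAt c (f zero) (f′ i)
  pos′ i = subst (λ w → 1 ≤ c w) (sym (punchIn-punchOut (f₀≢ i))) (pos (suc i))

≡ᶠ-true : ∀ {n} {w u : Fin n} → w ≡ u → (w ≡ᶠ u) ≡ true
≡ᶠ-true {w = w} {u} eq = trans (isYes≗does (w ≟ u)) (dec-true (w ≟ u) eq)

≡ᶠ-false : ∀ {n} {w u : Fin n} → w ≢ u → (w ≡ᶠ u) ≡ false
≡ᶠ-false {w = w} {u} ne = trans (isYes≗does (w ≟ u)) (dec-false (w ≟ u) ne)

∑-indicator-≡ᶠ : ∀ {n} (u : Fin n) → ∑[ w < n ] indicator (w ≡ᶠ u) ≡ 1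
∑-indicator-≡ᶠ {suc n} u = begin
  ∑ c                         ≡⟨ sum-remove {i = u} c ⟩
  c u + ∑ (removeAt c u)      ≡⟨ cong₂ _+_ (cong indicator (≡ᶠ-true refl))
                                       (sum-cong-≗ (λ i → cong indicator (≡ᶠ-false (punchInᵢ≢i u i)))) ⟩
  1 + ∑[ i < n ] 0            ≡⟨ cong suc (sum-replicate-zero n) ⟩
  1                           ∎
  where
  c : Vector ℕ (suc n)
  c w = indicator (w ≡ᶠ u)

indicator-cover : ∀ a b c d → T (a ∧ d) → 1 ≤ indicator (a ∧ not b ∧ not c ∧ d) + indicator b + indicator c
indicator-cover true true  c     true _ = s≤s z≤n
indicator-cover true false true  true _ = s≤s z≤n
indicator-cover true false false true _ = s≤s z≤n

-- A witness w distinguishing u and v is counted by sdIn unless w is u or v itself.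
≤-sdIn+2 : ∀ {g n} (G : Graph n) (S : Vec Bool n) u v {f : Fin g → Fin n} → Injective _≡_ _≡_ f →
  (∀ i → T (inS S (f i) ∧ (G u (f i) xor G v (f i)))) → g ≤ sdIn G S u v + 2
≤-sdIn+2 {g} {n} G S u v {f} f-inj separated =
  subst (g ≤_) total (injective⇒≤∑ c f-inj λ i →
    indicator-cover _ (f i ≡ᶠ u) (f i ≡ᶠ v) (G u (f i) xor G v (f i)) (separated i))
  where
  term isU isV : Fin n → ℕ
  term w = indicator (inS S w ∧ not (w ≡ᶠ u) ∧ not (w ≡ᶠ v) ∧ (G u w xor G v w))
  isU w = indicator (w ≡ᶠ u)
  isV w = indicator (w ≡ᶠ v)
  c : Vector ℕ n
  c w = term w + isU w + isV w
  total : ∑ c ≡ sdIn G S u v + 2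
  total = begin
    ∑ c                                        ≡⟨ ∑-distrib-+ (λ w → term w + isU w) isV ⟩
    ∑ (λ w → term w + isU w) + ∑ isV           ≡⟨ cong₂ _+_ (∑-distrib-+ term isU) (∑-indicator-≡ᶠ v) ⟩
    ∑ term + ∑ isU + 1                         ≡⟨ cong (λ k → ∑ term + k + 1) (∑-indicator-≡ᶠ u) ⟩
    ∑ term + 1 + 1                             ≡⟨ +-assoc (∑ term) 1 1 ⟩
    ∑ term + 2                                 ≡⟨ cong (_+ 2) (sum-map-tabulate (λ w → w) term) ⟨
    sdIn G S u v + 2                           ∎

∈-allSubsets : ∀ {n} (S : Vec Bool n) → S ∈ allSubsets n
∈-allSubsets Vec.[]            = here refl
∈-allSubsets (true Vec.∷ S)  = ∈-++⁺ˡ (∈-map⁺ (true Vec.∷_) (∈-allSubsets S))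
∈-allSubsets (false Vec.∷ S) = ∈-++⁺ʳ (map (true Vec.∷_) (allSubsets _)) (∈-map⁺ (false Vec.∷_) (∈-allSubsets S))

DistinctIn : ∀ {n} → Vec Bool n → Fin n × Fin n → Set
DistinctIn S (u , v) = T (inS S u) × T (inS S v) × u ≢ v

pairsIn-distinct : ∀ {n} (S : Vec Bool n) → All (DistinctIn S) (pairsIn S)
pairsIn-distinct {n} S = All.concat⁺ (All.map⁺ (All.universal (λ u →
  All.concat⁺ (All.map⁺ (All.universal (λ v → singleton u v) (allFin n)))) (allFin n)))
  where
  singleton : ∀ u v → All (DistinctIn S) (if inS S u ∧ inS S v ∧ not (u ≡ᶠ v) then (u , v) ∷ [] else [])
  singleton u v with inS S u in u∈S | inS S v in v∈S | u ≟ v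
  ... | true  | true  | no u≢v = (Equivalence.from T-≡ u∈S , Equivalence.from T-≡ v∈S , u≢v) All.∷ All.[]
  ... | true  | true  | yes _  = All.[]
  ... | true  | false | _      = All.[]
  ... | false | _     | _      = All.[]

-- minSd folds from the seed n, so only bounds b ≤ n can be passed through it.
≤-minSd : ∀ {n} (G : Graph n) (S : Vec Bool n) {b} → b ≤ n →
  (∀ {u v} → DistinctIn S (u , v) → b ≤ sdIn G S u v) → b ≤ minSd G S
≤-minSd G S {b} b≤n bound = foldr-preservesᵇ {P = b ≤_} ⊓-glb b≤n
  (All.map⁺ (All.map (λ {(u , v)} → bound {u} {v}) (pairsIn-distinct S)))

minSd≤sd : ∀ {n} (G : Graph n) (S : Vec Bool n) → 2 ≤ size S → minSd G S ≤ sd G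
minSd≤sd {n} G S 2≤∣S∣ = foldr-preservesᵒ {P = minSd G S ≤_} ≤-⊔ 0 _ (inj₂ (Any.map⁺ (Any.map F-S≤ (∈-allSubsets S))))
  where
  F : Vec Bool n → ℕ
  F S′ = if 2 ≤ᵇ size S′ then minSd G S′ else 0
  F-S≤ : ∀ {S′} → S ≡ S′ → minSd G S ≤ F S′
  F-S≤ refl rewrite Equivalence.to T-≡ (≤⇒≤ᵇ 2≤∣S∣) = ≤-refl
  ≤-⊔ : ∀ x y → minSd G S ≤ x ⊎ minSd G S ≤ y → minSd G S ≤ x ⊔ y
  ≤-⊔ x y = [ (λ le → ≤-trans le (m≤m⊔n x y)) , (λ le → ≤-trans le (m≤n⊔m x y)) ]

≤-sd : ∀ {n} (G : Graph n) (S : Vec Bool n) {b} → 2 ≤ size S → b ≤ n →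
  (∀ {u v} → DistinctIn S (u , v) → b ≤ sdIn G S u v) → b ≤ sd G
≤-sd G S 2≤∣S∣ b≤n bound = ≤-trans (≤-minSd G S b≤n bound) (minSd≤sd G S 2≤∣S∣)

module Circle (M : ℕ) .{{_ : NonZero M}} where

  cw : Fin M → Fin M → ℕ
  cw p q = (toℕ q + (M ∸ toℕ p)) % M

  cw<M : ∀ p q → cw p q < M
  cw<M p q = m%n<n _ M

  toℕ-mod : ∀ m → toℕ (m mod M) ≡ m % M
  toℕ-mod m = toℕ-fromℕ< (m%n<n m M)

  cw-spec : ∀ p q → (toℕ p + cw p q) % M ≡ toℕ q
  cw-spec p q = begin
    (P + (Q + (M ∸ P)) % M) % M  ≡⟨ %-absorbʳ P (Q + (M ∸ P)) M ⟩
    (P + (Q + (M ∸ P))) % M      ≡⟨ cong (_% M) rearrange ⟩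
    (Q + M) % M                  ≡⟨ [m+n]%n≡m%n Q M ⟩
    Q % M                        ≡⟨ m<n⇒m%n≡m (toℕ<n q) ⟩
    Q                            ∎
    where
    P = toℕ p
    Q = toℕ q
    rearrange : P + (Q + (M ∸ P)) ≡ Q + M
    rearrange = begin
      P + (Q + (M ∸ P))  ≡⟨ +-assoc P Q (M ∸ P) ⟨
      P + Q + (M ∸ P)    ≡⟨ cong (_+ (M ∸ P)) (+-comm P Q) ⟩
      Q + P + (M ∸ P)    ≡⟨ +-assoc Q P (M ∸ P) ⟩
      Q + (P + (M ∸ P))  ≡⟨ cong (Q +_) (m+[n∸m]≡n (<⇒≤ (toℕ<n p))) ⟩
      Q + M              ∎

  cw-unique : ∀ p q {e} → e < M → (toℕ p + e) % M ≡ toℕ q → cw p q ≡ e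
  cw-unique p q {e} e<M eq = begin
    (toℕ q + (M ∸ P)) % M              ≡⟨ cong (λ k → (k + (M ∸ P)) % M) eq ⟨
    ((P + e) % M + (M ∸ P)) % M        ≡⟨ %-absorbˡ (P + e) (M ∸ P) M ⟩
    (P + e + (M ∸ P)) % M              ≡⟨ cong (_% M) rearrange ⟩
    (e + M) % M                        ≡⟨ [m+n]%n≡m%n e M ⟩
    e % M                              ≡⟨ m<n⇒m%n≡m e<M ⟩
    e                                  ∎
    where
    P = toℕ p
    rearrange : P + e + (M ∸ P) ≡ e + M
    rearrange = begin
      P + e + (M ∸ P)    ≡⟨ cong (_+ (M ∸ P)) (+-comm P e) ⟩
      e + P + (M ∸ P)    ≡⟨ +-assoc e P (M ∸ P) ⟩
      e + (P + (M ∸ P))  ≡⟨ cong (e +_) (m+[n∸m]≡n (<⇒≤ (toℕ<n p))) ⟩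
      e + M              ∎

  cw-self : ∀ p → cw p p ≡ 0
  cw-self p = cw-unique p p (>-nonZero⁻¹ M)
    (trans (cong (_% M) (+-identityʳ (toℕ p))) (m<n⇒m%n≡m (toℕ<n p)))

  cw-≡0 : ∀ {p q} → cw p q ≡ 0 → p ≡ q
  cw-≡0 {p} {q} eq = toℕ-injective (begin
    toℕ p                ≡⟨ m<n⇒m%n≡m (toℕ<n p) ⟨
    toℕ p % M            ≡⟨ cong (_% M) (+-identityʳ (toℕ p)) ⟨
    (toℕ p + 0) % M      ≡⟨ cong (λ k → (toℕ p + k) % M) eq ⟨
    (toℕ p + cw p q) % M ≡⟨ cw-spec p q ⟩
    toℕ q                ∎)

  cw-triangle : ∀ x y z → cw x z ≡ (cw x y + cw y z) % M
  cw-triangle x y z = cw-unique x z (m%n<n _ M) (begin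
    (X + (cw x y + cw y z) % M) % M  ≡⟨ %-absorbʳ X (cw x y + cw y z) M ⟩
    (X + (cw x y + cw y z)) % M      ≡⟨ cong (_% M) (+-assoc X (cw x y) (cw y z)) ⟨
    (X + cw x y + cw y z) % M        ≡⟨ %-absorbˡ (X + cw x y) (cw y z) M ⟨
    ((X + cw x y) % M + cw y z) % M  ≡⟨ cong (λ k → (k + cw y z) % M) (cw-spec x y) ⟩
    (toℕ y + cw y z) % M             ≡⟨ cw-spec y z ⟩
    toℕ z                            ∎)
    where X = toℕ x

  cw-path : ∀ x y z → cw x y + cw y z ≡ cw x z ⊎ cw x y + cw y z ≡ cw x z + M
  cw-path x y z with %-split (+-mono-< (cw<M x y) (cw<M y z))
  ... | inj₁ eq = inj₁ (trans (sym eq) (sym (cw-triangle x y z)))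
  ... | inj₂ eq = inj₂ (trans (sym eq) (cong (_+ M) (sym (cw-triangle x y z))))

  cw-path-< : ∀ x y z → cw x y + cw y z < M → cw x y + cw y z ≡ cw x z
  cw-path-< x y z lt with cw-path x y z
  ... | inj₁ eq = eq
  ... | inj₂ eq = contradiction (subst (M ≤_) (sym eq) (m≤n+m M (cw x z))) (<⇒≱ lt)

  cw-path-≤ˡ : ∀ x y z → cw x y ≤ cw x z → cw x y + cw y z ≡ cw x z
  cw-path-≤ˡ x y z le with cw-path x y z
  ... | inj₁ eq = eq
  ... | inj₂ eq = contradiction
    (+-cancelˡ-≤ (cw x y) M (cw y z) (subst (cw x y + M ≤_) (sym eq) (+-monoˡ-≤ M le)))
    (<⇒≱ (cw<M y z))

  cw-path-≤ʳ : ∀ x y z → cw y z ≤ cw x z → cw x y + cw y z ≡ cw x z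
  cw-path-≤ʳ x y z le with cw-path x y z
  ... | inj₁ eq = eq
  ... | inj₂ eq = contradiction
    (+-cancelʳ-≤ (cw y z) M (cw x y)
      (subst (M + cw y z ≤_) (trans (+-comm M (cw x z)) (sym eq)) (+-monoʳ-≤ M le)))
    (<⇒≱ (cw<M x y))

  _⊕_ : Fin M → ℕ → Fin M
  x ⊕ d = (toℕ x + d) mod M

  _⊖_ : Fin M → ℕ → Fin M
  x ⊖ d = (toℕ x + (M ∸ d)) mod M

  cw-⊕ : ∀ x {d} → d < M → cw x (x ⊕ d) ≡ d
  cw-⊕ x d<M = cw-unique x (x ⊕ _) d<M (sym (toℕ-mod _))

  cw-⊖ : ∀ x {d} → d < M → cw (x ⊖ d) x ≡ d
  cw-⊖ x {d} d<M = cw-unique (x ⊖ d) x d<M (begin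
    (toℕ (x ⊖ d) + d) % M         ≡⟨ cong (λ k → (k + d) % M) (toℕ-mod (X + (M ∸ d))) ⟩
    ((X + (M ∸ d)) % M + d) % M   ≡⟨ %-absorbˡ (X + (M ∸ d)) d M ⟩
    (X + (M ∸ d) + d) % M         ≡⟨ cong (_% M) (+-assoc X (M ∸ d) d) ⟩
    (X + (M ∸ d + d)) % M         ≡⟨ cong (λ k → (X + k) % M) (m∸n+n≡m (<⇒≤ d<M)) ⟩
    (X + M) % M                   ≡⟨ [m+n]%n≡m%n X M ⟩
    X % M                         ≡⟨ m<n⇒m%n≡m (toℕ<n x) ⟩
    X                             ∎)
    where X = toℕ x

  cw-injectiveʳ : ∀ a {x y} → cw a x ≡ cw a y → x ≡ y
  cw-injectiveʳ a {x} {y} eq = toℕ-injective (begin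
    toℕ x                 ≡⟨ cw-spec a x ⟨
    (toℕ a + cw a x) % M  ≡⟨ cong (λ k → (toℕ a + k) % M) eq ⟩
    (toℕ a + cw a y) % M  ≡⟨ cw-spec a y ⟩
    toℕ y                 ∎)

  ⊖-injectiveˡ : ∀ {x y d} → d < M → x ⊖ d ≡ y ⊖ d → x ≡ y
  ⊖-injectiveˡ {x} {y} {d} d<M eq =
    cw-injectiveʳ (x ⊖ d) (trans (cw-⊖ x d<M) (sym (trans (cong (λ a → cw a y) eq) (cw-⊖ y d<M))))

  onArc⇔ : ∀ s l p → T (onArc (arc s l) p) ⇔ cw s p ≤ toℕ l
  onArc⇔ s l p = mk⇔ to from
    where
    S = toℕ s
    L = toℕ l
    P = toℕ p

    within : ∀ {y} → S ≤ y × y ≤ S + L → y % M ≡ P → cw s p ≤ L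
    within {y} (S≤y , y≤S+L) y≡p = subst (_≤ L) (sym (cw-unique s p (≤-<-trans y∸S≤L (toℕ<n l)) eq)) y∸S≤L
      where
      y∸S≤L : y ∸ S ≤ L
      y∸S≤L = m≤n+o⇒m∸n≤o y S y≤S+L
      eq : (S + (y ∸ S)) % M ≡ P
      eq = trans (cong (_% M) (m+[n∸m]≡n S≤y)) y≡p

    to : T (onArc (arc s l) p) → cw s p ≤ L
    to t with Equivalence.to T-∨ t
    ... | inj₁ t₁ = within (Equivalence.to (inInterval⇔ _ _ _) t₁) (m<n⇒m%n≡m (toℕ<n p))
    ... | inj₂ t₂ = within (Equivalence.to (inInterval⇔ _ _ _) t₂)
                      (trans ([m+n]%n≡m%n P M) (m<n⇒m%n≡m (toℕ<n p)))

    bounds : cw s p ≤ L → ∀ {y} → S + cw s p ≡ y → S ≤ y × y ≤ S + L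
    bounds d≤L refl = m≤m+n S _ , +-monoʳ-≤ S d≤L

    from : cw s p ≤ L → T (onArc (arc s l) p)
    from d≤L with %-split (+-mono-< (toℕ<n s) (cw<M s p))
    ... | inj₁ eq = Equivalence.from T-∨ (inj₁ (Equivalence.from (inInterval⇔ _ _ _)
                      (bounds d≤L (trans (sym eq) (cw-spec s p)))))
    ... | inj₂ eq = Equivalence.from T-∨ (inj₂ (Equivalence.from (inInterval⇔ _ _ _)
                      (bounds d≤L (trans (sym eq) (cong (_+ M) (cw-spec s p))))))

  intersects⇔ : ∀ x l z j → toℕ l + toℕ j < M →
    T (intersects (arc x l) (arc z j)) ⇔ cw (x ⊖ toℕ j) z ≤ toℕ l + toℕ j
  intersects⇔ x l z j L+J<M = mk⇔ to from
    where
    L = toℕ l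
    J = toℕ j
    a = x ⊖ J

    ax≡J : cw a x ≡ J
    ax≡J = cw-⊖ x (≤-<-trans (m≤n+m J L) L+J<M)

    J+≤L+J : ∀ {d} → d ≤ L → J + d ≤ L + J
    J+≤L+J {d} d≤L = subst (J + d ≤_) (+-comm J L) (+-monoʳ-≤ J d≤L)

    common : ∀ p → cw x p ≤ L → cw z p ≤ J → T (intersects (arc x l) (arc z j))
    common p xp≤L zp≤J = Equivalence.from (T-any-allFin _)
      (p , Equivalence.from T-∧ (Equivalence.from (onArc⇔ x l p) xp≤L , Equivalence.from (onArc⇔ z j p) zp≤J))

    to : T (intersects (arc x l) (arc z j)) → cw a z ≤ L + J
    to t with Equivalence.to (T-any-allFin _) t
    ... | p , t′ with Equivalence.to T-∧ t′
    ... | xp , zp = ≤-trans az≤ap (subst (_≤ L + J) J+xp≡ap (J+≤L+J xp≤L))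
      where
      xp≤L : cw x p ≤ L
      xp≤L = Equivalence.to (onArc⇔ x l p) xp
      zp≤J : cw z p ≤ J
      zp≤J = Equivalence.to (onArc⇔ z j p) zp
      J+xp≡ap : J + cw x p ≡ cw a p
      J+xp≡ap = subst (λ k → k + cw x p ≡ cw a p) ax≡J
        (cw-path-< a x p (subst (λ k → k + cw x p < M) (sym ax≡J) (≤-<-trans (J+≤L+J xp≤L) L+J<M)))
      az≤ap : cw a z ≤ cw a p
      az≤ap = subst (cw a z ≤_) (cw-path-≤ʳ a z p (≤-trans zp≤J (subst (J ≤_) J+xp≡ap (m≤m+n J _))))
        (m≤m+n (cw a z) (cw z p))

    from : cw a z ≤ L + J → T (intersects (arc x l) (arc z j))
    from az≤L+J with J ≤? cw a z
    ... | yes J≤az = common z xz≤L (subst (_≤ J) (sym (cw-self z)) z≤n)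
      where
      J+xz≡az : J + cw x z ≡ cw a z
      J+xz≡az = subst (λ k → k + cw x z ≡ cw a z) ax≡J (cw-path-≤ˡ a x z (subst (_≤ cw a z) (sym ax≡J) J≤az))
      xz≤L : cw x z ≤ L
      xz≤L = +-cancelˡ-≤ J (cw x z) L (subst (_≤ J + L) (sym J+xz≡az) (subst (cw a z ≤_) (+-comm L J) az≤L+J))
    ... | no J≰az = common x (subst (_≤ L) (sym (cw-self x)) z≤n) zx≤J
      where
      az+zx≡J : cw a z + cw z x ≡ J
      az+zx≡J = trans (cw-path-≤ˡ a z x (subst (cw a z ≤_) (sym ax≡J) (<⇒≤ (≰⇒> J≰az)))) ax≡J
      zx≤J : cw z x ≤ J
      zx≤J = subst (cw z x ≤_) az+zx≡J (m≤n+m (cw z x) (cw a z))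

  Separates : Fin M → ℕ → Fin M → ℕ → Fin M → Set
  Separates a L b L′ z = (cw a z ≤ L × L′ < cw b z) ⊎ (L < cw a z × cw b z ≤ L′)

  -- suc L < M: the point just before the start a is not on the arc (a, L)
  separatingPoint : ∀ a L b L′ → suc L < M → suc L′ < M → ¬ (a ≡ b × L ≡ L′) → ∃[ z ] Separates a L b L′ z
  separatingPoint a L b L′ L<M L′<M distinct with a ≟ b
  ... | yes refl with <-cmp L L′
  ...   | tri< L<L′ _ _ = a ⊕ L′ , inj₂ (subst (L <_) (sym az≡L′) L<L′ , ≤-reflexive az≡L′)
    where az≡L′ = cw-⊕ a (<⇒≤ L′<M)
  ...   | tri≈ _ L≡L′ _ = contradiction (refl , L≡L′) distinct
  ...   | tri> _ _ L′<L = a ⊕ L , inj₁ (≤-reflexive az≡L , subst (L′ <_) (sym az≡L) L′<L)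
    where az≡L = cw-⊕ a (<⇒≤ L<M)
  separatingPoint a L b L′ L<M L′<M distinct | no a≢b with L′ <? cw b a
  ... | yes L′<ba = a , inj₁ (subst (_≤ L) (sym (cw-self a)) z≤n , L′<ba)
  ... | no L′≮ba = a ⊖ 1 , inj₂ (L<az , bz≤L′)
    where
    z = a ⊖ 1
    za≡1 : cw z a ≡ 1
    za≡1 = cw-⊖ a (≤-<-trans (s≤s z≤n) L<M)
    az+1≡M : cw a z + 1 ≡ M
    az+1≡M with cw-path a z a
    ... | inj₁ eq = contradiction (trans (sym (cong (cw a z +_) za≡1)) (trans eq (cw-self a))) (m+1+n≢0 (cw a z))
    ... | inj₂ eq = subst (λ k → cw a z + k ≡ M) za≡1 (trans eq (cong (_+ M) (cw-self a)))
    L<az : L < cw a z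
    L<az = s≤s⁻¹ (subst (suc (suc L) ≤_) (trans (sym az+1≡M) (+-comm (cw a z) 1)) L<M)
    bz+1≡ba : cw b z + 1 ≡ cw b a
    bz+1≡ba = subst (λ k → cw b z + k ≡ cw b a) za≡1
      (cw-path-≤ʳ b z a (subst (_≤ cw b a) (sym za≡1) (n≢0⇒n>0 (λ ba≡0 → a≢b (sym (cw-≡0 ba≡0))))))
    bz≤L′ : cw b z ≤ L′
    bz≤L′ = ≤-trans (m≤m+n (cw b z) 1) (subst (_≤ L′) (sym bz+1≡ba) (≮⇒≥ L′≮ba))

  distinguishingArc : ∀ x l y m j → suc (toℕ l + toℕ j) < M → suc (toℕ m + toℕ j) < M → ¬ (x ≡ y × l ≡ m) →
    ∃[ z ] T (intersects (arc x l) (arc z j) xor intersects (arc y m) (arc z j))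
  distinguishingArc x l y m j lj<M mj<M distinct =
    map₂ separates⇒xor (separatingPoint (x ⊖ J) (L + J) (y ⊖ J) (L′ + J) lj<M mj<M shifted-distinct)
    where
    L = toℕ l
    L′ = toℕ m
    J = toℕ j

    shifted-distinct : ¬ (x ⊖ J ≡ y ⊖ J × L + J ≡ L′ + J)
    shifted-distinct (e₁ , e₂) = distinct (⊖-injectiveˡ (toℕ<n j) e₁ , toℕ-injective (+-cancelʳ-≡ J L L′ e₂))

    separates⇒xor : ∀ {z} → Separates (x ⊖ J) (L + J) (y ⊖ J) (L′ + J) z →
      T (intersects (arc x l) (arc z j) xor intersects (arc y m) (arc z j))
    separates⇒xor {z} (inj₁ (on-x , off-y)) =
      T-xor (inj₁ (Equivalence.from meets-x on-x , λ t → <⇒≱ off-y (Equivalence.to meets-y t)))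
      where
      meets-x = intersects⇔ x l z j (<⇒≤ lj<M)
      meets-y = intersects⇔ y m z j (<⇒≤ mj<M)
    separates⇒xor {z} (inj₂ (off-x , on-y)) =
      T-xor (inj₂ ((λ t → <⇒≱ off-x (Equivalence.to meets-x t)) , Equivalence.from meets-y on-y))
      where
      meets-x = intersects⇔ x l z j (<⇒≤ lj<M)
      meets-y = intersects⇔ y m z j (<⇒≤ mj<M)

arcCount : ℕ → ℕ
arcCount h = (h + h) * h

module ArcGraph (h : ℕ) .{{_ : NonZero h}} where

  M : ℕ
  M = h + h

  instance
    M-nonZero : NonZero M
    M-nonZero = >-nonZero (≤-trans (>-nonZero⁻¹ h) (m≤m+n h h))

  open Circle M

  K : ℕ
  K = arcCount h

  -- The vertices i < K are the K arcs of length < h, each exactly once.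
  arcOf : ℕ → Arc M
  arcOf i = arc ((i / h) mod M) ((i mod h) ↑ˡ h)

  arcGraph : ∀ n → Graph n
  arcGraph n u w = intersects (arcOf (toℕ u)) (arcOf (toℕ w))

  arcGraph-circularArc : ∀ n → IsCircularArcGraph (arcGraph n)
  arcGraph-circularArc n = M , arcOf ∘ toℕ , λ _ _ _ → refl

  core : ∀ n → Vec Bool n
  core n = tabulate (λ i → toℕ i <ᵇ K)

  toℕ-start : ∀ {i} → i < K → toℕ (start (arcOf i)) ≡ i / h
  toℕ-start {i} i<K = trans (toℕ-mod (i / h)) (m<n⇒m%n≡m (m<n*o⇒m/o<n {n = M} i<K))

  toℕ-len : ∀ i → toℕ (len (arcOf i)) ≡ i % h
  toℕ-len i = trans (toℕ-↑ˡ (i mod h) h) (toℕ-fromℕ< (m%n<n i h))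

  arcOf-injective : ∀ {i i′} → i < K → i′ < K → arcOf i ≡ arcOf i′ → i ≡ i′
  arcOf-injective {i} {i′} i<K i′<K eq = begin
    i                    ≡⟨ m≡m%n+[m/n]*n i h ⟩
    i % h + (i / h) * h  ≡⟨ cong₂ (λ r q → r + q * h) same-len same-start ⟩
    i′ % h + (i′ / h) * h ≡⟨ m≡m%n+[m/n]*n i′ h ⟨
    i′                   ∎
    where
    same-start : i / h ≡ i′ / h
    same-start = trans (sym (toℕ-start i<K)) (trans (cong (toℕ ∘ start) eq) (toℕ-start i′<K))
    same-len : i % h ≡ i′ % h
    same-len = trans (sym (toℕ-len i)) (trans (cong (toℕ ∘ len) eq) (toℕ-len i′))

  encode : Fin M → Fin h → ℕ
  encode z j = toℕ j + toℕ z * h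

  encode<K : ∀ z j → encode z j < K
  encode<K z j = <-≤-trans (+-monoˡ-< (toℕ z * h) (toℕ<n j)) (*-monoˡ-≤ h (toℕ<n z))

  arcOf-encode : ∀ z j → arcOf (encode z j) ≡ arc z (j ↑ˡ h)
  arcOf-encode z j = cong₂ arc (toℕ-injective start≡) (toℕ-injective len≡)
    where
    quotient : encode z j / h ≡ toℕ z
    quotient = begin
      (toℕ j + toℕ z * h) / h       ≡⟨ +-distrib-/-∣ʳ (toℕ j) (n∣m*n (toℕ z)) ⟩
      toℕ j / h + toℕ z * h / h     ≡⟨ cong₂ _+_ (m<n⇒m/n≡0 (toℕ<n j)) (m*n/n≡m (toℕ z) h) ⟩
      toℕ z                         ∎
    remainder : encode z j % h ≡ toℕ j
    remainder = trans ([m+kn]%n≡m%n (toℕ j) (toℕ z) h) (m<n⇒m%n≡m (toℕ<n j))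
    start≡ : toℕ (start (arcOf (encode z j))) ≡ toℕ z
    start≡ = trans (toℕ-start (encode<K z j)) quotient
    len≡ : toℕ (len (arcOf (encode z j))) ≡ toℕ (j ↑ˡ h)
    len≡ = trans (toℕ-len (encode z j)) (trans remainder (sym (toℕ-↑ˡ j h)))

  suc[a+b]<M : ∀ {a b} → a < h → b < h → suc (a + b) < M
  suc[a+b]<M {a} {b} a<h b<h = subst (_≤ M) (cong suc (+-suc a b)) (+-mono-≤ a<h b<h)

  ∈core⇒<K : ∀ {n} (u : Fin n) → T (inS (core n) u) → toℕ u < K
  ∈core⇒<K u u∈ = <ᵇ⇒< _ K (subst T (lookup∘tabulate _ u) u∈)

  <K⇒∈core : ∀ {n} (u : Fin n) → toℕ u < K → T (inS (core n) u)
  <K⇒∈core u u<K = subst T (sym (lookup∘tabulate _ u)) (<⇒<ᵇ u<K)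

  h≤sdIn+2 : ∀ {n} → K ≤ n → ∀ {u v} → DistinctIn (core n) (u , v) → h ≤ sdIn (arcGraph n) (core n) u v + 2
  h≤sdIn+2 {n} K≤n {u} {v} (u∈ , v∈ , u≢v) = ≤-sdIn+2 (arcGraph n) (core n) u v f-injective separated
    where
    A = arcOf (toℕ u)
    B = arcOf (toℕ v)

    distinct : ¬ (start A ≡ start B × len A ≡ len B)
    distinct (e₁ , e₂) = u≢v (toℕ-injective (arcOf-injective (∈core⇒<K u u∈) (∈core⇒<K v v∈) (cong₂ arc e₁ e₂)))

    len<h : ∀ i → toℕ (len (arcOf i)) < h
    len<h i = subst (_< h) (sym (toℕ-len i)) (m%n<n i h)

    witness : (j : Fin h) → ∃[ z ] T (intersects A (arc z (j ↑ˡ h)) xor intersects B (arc z (j ↑ˡ h)))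
    witness j = distinguishingArc (start A) (len A) (start B) (len B) (j ↑ˡ h)
      (suc[a+b]<M (len<h (toℕ u)) j<h) (suc[a+b]<M (len<h (toℕ v)) j<h) distinct
      where j<h = subst (_< h) (sym (toℕ-↑ˡ j h)) (toℕ<n j)

    z : Fin h → Fin M
    z j = proj₁ (witness j)

    f : Fin h → Fin n
    f j = fromℕ< (<-≤-trans (encode<K (z j) j) K≤n)

    arcOf-f : ∀ j → arcOf (toℕ (f j)) ≡ arc (z j) (j ↑ˡ h)
    arcOf-f j = trans (cong arcOf (toℕ-fromℕ< _)) (arcOf-encode (z j) j)

    f-injective : Injective _≡_ _≡_ f
    f-injective {i} {j} eq = ↑ˡ-injective h i j
      (cong len (trans (sym (arcOf-f i)) (trans (cong (arcOf ∘ toℕ) eq) (arcOf-f j))))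

    separated : ∀ j → T (inS (core n) (f j) ∧ (arcGraph n u (f j) xor arcGraph n v (f j)))
    separated j = Equivalence.from T-∧
      ( <K⇒∈core (f j) (subst (_< K) (sym (toℕ-fromℕ< _)) (encode<K (z j) j))
      , subst (λ a → T (intersects A a xor intersects B a)) (sym (arcOf-f j)) (proj₂ (witness j)))

  2≤size-core : ∀ {n} → K ≤ n → 2 ≤ size (core n)
  2≤size-core {n} K≤n = subst (2 ≤_) (sym (size-tabulate {n} (λ i → toℕ i <ᵇ K)))
    (injective⇒≤∑ (λ i → indicator (toℕ i <ᵇ K)) {f = λ i → inject≤ i 2≤n} (inject≤-injective 2≤n 2≤n _ _) in-core)
    where
    2≤K : 2 ≤ K
    2≤K = *-mono-≤ (+-mono-≤ (>-nonZero⁻¹ h) (>-nonZero⁻¹ h)) (>-nonZero⁻¹ h)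
    2≤n = ≤-trans 2≤K K≤n
    in-core : ∀ (i : Fin 2) → 1 ≤ indicator (toℕ (inject≤ i 2≤n) <ᵇ K)
    in-core i rewrite toℕ-inject≤ i 2≤n | Equivalence.to T-≡ (<⇒<ᵇ (<-≤-trans (toℕ<n i) 2≤K)) = ≤-refl

  h∸2≤sd : ∀ {n} → K ≤ n → h ∸ 2 ≤ sd (arcGraph n)
  h∸2≤sd {n} K≤n = ≤-sd (arcGraph n) (core n) (2≤size-core K≤n) h∸2≤n
    (λ uv → m≤n+o⇒m∸n≤o h 2 (subst (h ≤_) (+-comm _ 2) (h≤sdIn+2 K≤n uv)))
    where
    h∸2≤n : h ∸ 2 ≤ n
    h∸2≤n = ≤-trans (m∸n≤m h 2) (≤-trans (m≤n*m h M) K≤n)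

arcCount-mono-≤ : ∀ {a b} → a ≤ b → arcCount a ≤ arcCount b
arcCount-mono-≤ a≤b = *-mono-≤ (+-mono-≤ a≤b a≤b) a≤b

arcCount-mono-< : ∀ {a b} → a < b → arcCount a < arcCount b
arcCount-mono-< a<b = *-mono-< (+-mono-< a<b a<b) a<b

arcCount[4*a]≡32*a² : ∀ a → (4 * a + 4 * a) * (4 * a) ≡ 32 * (a * a)
arcCount[4*a]≡32*a² = solve-∀

arcCount-4+ : ∀ t → arcCount (4 + t) ≤ 32 * (suc t * suc t)
arcCount-4+ t = subst (arcCount (4 + t) ≤_) (arcCount[4*a]≡32*a² (suc t))
  (arcCount-mono-≤ (subst (4 + t ≤_) (sym (*-suc 4 t)) (+-monoʳ-≤ 4 (m≤n*m t 4))))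

root : ℕ → ℕ
root zero    = 0
root (suc n) = if arcCount (suc (root n)) ≤ᵇ suc n then suc (root n) else root n

root-spec : ∀ n → arcCount (root n) ≤ n × n < arcCount (suc (root n))
root-spec zero = z≤n , s≤s z≤n
root-spec (suc n) with root-spec n | arcCount (suc (root n)) ≤ᵇ suc n in fits
... | _ , n<next | true  = ≤ᵇ⇒≤ _ _ (Equivalence.from T-≡ fits) , <-≤-trans (s≤s n<next) (arcCount-mono-< (n<1+n (suc (root n))))
... | r≤n , _    | false = m≤n⇒m≤1+n r≤n , ≰⇒> (λ le → subst T fits (≤⇒≤ᵇ le))

3≤root : ∀ {n} → arcCount 3 ≤ n → 3 ≤ root n
3≤root {n} 18≤n = ≮⇒≥ (λ r<3 → <⇒≱ (<-≤-trans (proj₂ (root-spec n)) (arcCount-mono-≤ r<3)) 18≤n)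

arcGraph-sd : ∀ n h → 3 ≤ h → arcCount h ≤ n → n < arcCount (suc h) →
  Σ (Graph n) λ G → IsCircularArcGraph G × (n ≤ 32 * (sd G * sd G))
arcGraph-sd n (suc (suc (suc t))) (s≤s (s≤s (s≤s _))) K≤n n<next = arcGraph n , arcGraph-circularArc n , n≤32sd²
  where
  open ArcGraph (3 + t)
  n≤32sd² : n ≤ 32 * (sd (arcGraph n) * sd (arcGraph n))
  n≤32sd² = ≤-trans (<⇒≤ n<next)
    (≤-trans (arcCount-4+ t) (*-monoʳ-≤ 32 (*-mono-≤ (h∸2≤sd K≤n) (h∸2≤sd K≤n))))

theorem5 : ∃[ k ] ∃[ N ] ∀ (n : ℕ) → N ≤ n →
    Σ (Graph n) λ G → IsCircularArcGraph G × (n ≤ k * (sd G * sd G))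
theorem5 = 32 , 18 , λ n 18≤n →
  arcGraph-sd n (root n) (3≤root 18≤n) (proj₁ (root-spec n)) (proj₂ (root-spec n))
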